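{- Let $G$ be a game structure of imperfect information and $\phi$ an objective. There exists a deterministic observation-based Player-1 strategy $\alpha^o$ such that for all deterministic Player-2 strategies $\beta$ the play $\mathsf{outcome}(G,\alpha^o,\beta)$ satisfies $\phi$ if and only if there exists a deterministic observation-based Player-1 strategy $\alpha^o$ such that for all counting Player-2 strategies $\beta^c$ the play $\mathsf{outcome}(G,\alpha^o,\beta^c)$ satisfies $\phi$.
   Context: Game structure $G=\langle L,l_0,\Sigma,\Delta,\mathcal{O},\gamma\rangle$: $L$ finite states, $l_0$ initial, $\Sigma$ finite alphabet, $\Delta\subseteq L\times\Sigma\times L$ total (every state has a $\sigma$-successor for every $\sigma$), $\mathcal{O}$ finite observations, $\gamma:\mathcal{O}\to2^L\setminus\{\emptyset\}$ partitioning $L$. Plays are $\ell_0\sigma_0\ell_1\dots$ with $\ell_0=l_0$ and $(\ell_i,\sigma_i,\ell_{i+1})\in\Delta$; $\mathrm{Prefs}(G)$ is the set of finite prefixes $\ell_0\sigma_0\dots\ell_n$, of length $n+1$, with last state $\mathsf{Last}$. Observation sequence: $o_0\sigma_0o_1\dots$ with $\ell_i\in\gamma(o_i)$. A deterministic Player-1 strategy $\alpha:\mathrm{Prefs}(G)\to\Sigma$ is observation-based if it agrees on prefixes with equal observation sequences. A deterministic Player-2 strategy is $\beta:\mathrm{Prefs}(G)\times\Sigma\to L$ with $(\mathsf{Last}(\rho),\sigma,\beta(\rho,\sigma))\in\Delta$. $\beta$ is counting if $\beta(\rho,\sigma)=\beta(\rho',\sigma)$ whenever $\rho,\rho'$ have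 the same length and the same last state. $\mathsf{outcome}(G,\alpha,\beta)$ is the play with $\sigma_i=\alpha(\pi(i))$ and $\ell_{i+1}=\beta(\pi(i),\sigma_i)$, where $\pi(i)$ is the prefix up to $\ell_i$. An objective is a set $\phi\subseteq(\mathcal{O}\times\Sigma)^\omega$, satisfied by a play if its observation sequence belongs to $\phi$. -}

module Defs where

open import Data.Nat using (ℕ; zero; suc)
open import Data.Fin using (Fin)
open import Data.Product using (Σ; ∃; _×_; _,_; proj₁; proj₂)
open import Relation.Binary.PropositionalEquality using (_≡_)

-- L, Σ, 𝒪 are finite sets, represented as Fin nL, Fin nΣ, Fin nO.
-- The partition γ : 𝒪 → 2^L \ {∅} of L is represented by the map
-- obs : L → 𝒪 sending a state to the unique block containing it,
-- i.e. γ(o) = { l | obs l ≡ o }; nonemptiness of blocks = surjectivity.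
record GameStructure : Set₁ where
  field
    nL nΣ nO : ℕ
  L : Set
  L = Fin nL
  Act : Set
  Act = Fin nΣ
  Obs : Set
  Obs = Fin nO
  field
    l₀    : L
    Δ     : L → Act → L → Set
    total : ∀ (l : L) (σ : Act) → ∃ λ l' → Δ l σ l'
    obs   : L → Obs
    γ-nonempty : ∀ (o : Obs) → ∃ λ l → obs l ≡ o

  γ : Obs → L → Set
  γ o l = obs l ≡ o

  -- Prefixes ℓ₀σ₀…ℓₙ of plays (indexed by n, the number of moves;
  -- the prefix has length n+1), starting at l₀, following Δ.
  mutual
    data Pref : ℕ → Set where
      start : Pref zero
      step  : ∀ {n} (ρ : Pref n) (σ : Act) (l : L) → Δ (Last ρ) σ l → Pref (suc n)

    Last : ∀ {n} → Pref n → L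
    Last start = l₀
    Last (step ρ σ l _) = l

  data ObsSeq : ℕ → Set where
    ostart : Obs → ObsSeq zero
    ostep  : ∀ {n} → ObsSeq n → Act → Obs → ObsSeq (suc n)

  obsSeq : ∀ {n} → Pref n → ObsSeq n
  obsSeq start = ostart (obs l₀)
  obsSeq (step ρ σ l _) = ostep (obsSeq ρ) σ (obs l)

  Strategy₁ : Set
  Strategy₁ = ∀ {n} → Pref n → Act

  ObservationBased : Strategy₁ → Set
  -- Agreement on prefixes with equal observation sequences (equal
  -- observation sequences force equal length, so only same-length
  -- prefixes need to be compared).
  ObservationBased α = ∀ {n} (ρ ρ' : Pref n) →
    obsSeq ρ ≡ obsSeq ρ' → α ρ ≡ α ρ'

  Strategy₂ : Set
  Strategy₂ = ∀ {n} (ρ : Pref n) (σ : Act) → Σ L (Δ (Last ρ) σ)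

  Counting : Strategy₂ → Set
  Counting β = ∀ {n} (ρ ρ' : Pref n) → Last ρ ≡ Last ρ' →
    ∀ (σ : Act) → proj₁ (β ρ σ) ≡ proj₁ (β ρ' σ)

  outcomePref : Strategy₁ → Strategy₂ → (i : ℕ) → Pref i
  outcomePref α β zero = start
  outcomePref α β (suc i) =
    let ρ = outcomePref α β i
        σ = α ρ
    in step ρ σ (proj₁ (β ρ σ)) (proj₂ (β ρ σ))

  outcomeState : Strategy₁ → Strategy₂ → ℕ → L
  outcomeState α β i = Last (outcomePref α β i)

  outcomeAction : Strategy₁ → Strategy₂ → ℕ → Act
  outcomeAction α β i = α (outcomePref α β i)

  outcomeObs : Strategy₁ → Strategy₂ → ℕ → Obs × Act
  outcomeObs α β i = obs (outcomeState α β i) , outcomeAction α β i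

  -- An objective φ ⊆ (𝒪 × Σ)^ω. Infinite sequences are functions
  -- ℕ → 𝒪 × Σ; a subset must respect pointwise equality of sequences
  -- (two sequences that agree everywhere are the same element).
  record Objective : Set₁ where
    field
      φ       : (ℕ → Obs × Act) → Set
      φ-resp  : ∀ {s t : ℕ → Obs × Act} → (∀ i → s i ≡ t i) → φ s → φ t

  Satisfies : Objective → Strategy₁ → Strategy₂ → Set
  Satisfies Φ α β = Objective.φ Φ (outcomeObs α β)

-- Counting strategies are as strong as arbitrary ones against a fixed Player-1
-- strategy α: a play α produces against β can be replayed by a counting strategy
-- that, at step n, moves as β does from the state the β-play is in at step n
-- (and arbitrarily from any other state). α then meets the same states, hence
-- the same observations, and chooses the same actions.
module Submission where

open import Defs
open import Data.Product using (Σ; _×_; _,_; proj₁; proj₂)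
open import Function.Bundles using (_⇔_; mk⇔)
open import Data.Nat using (ℕ; zero; suc)
open import Data.Fin using (_≟_)
open import Relation.Nullary using (yes; no; contradiction)
open import Relation.Binary.PropositionalEquality using (_≡_; refl; sym; trans; cong; cong₂; subst)

module _ (G : GameStructure) where
  open GameStructure G

  followAt : (∀ n → Pref n) → Strategy₂ → (n : ℕ) (l : L) (σ : Act) → Σ L (Δ l σ)
  followAt π β n l σ with l ≟ Last (π n)
  ... | yes l≡last = proj₁ (β (π n) σ) , subst (λ l' → Δ l' σ _) (sym l≡last) (proj₂ (β (π n) σ))
  ... | no _ = total l σ

  follow : (∀ n → Pref n) → Strategy₂ → Strategy₂
  follow π β {n} ρ = followAt π β n (Last ρ)

  follow-counting : (π : ∀ n → Pref n) (β : Strategy₂) → Counting (follow π β)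
  follow-counting π β {n} _ _ sameLast σ = cong (λ l → proj₁ (followAt π β n l σ)) sameLast

  followAt-agrees : (π : ∀ n → Pref n) (β : Strategy₂) (n : ℕ) {l : L} →
                    l ≡ Last (π n) → (σ : Act) →
                    proj₁ (followAt π β n l σ) ≡ proj₁ (β (π n) σ)
  followAt-agrees π β n {l} l≡last σ with l ≟ Last (π n)
  ... | yes _ = refl
  ... | no l≢last = contradiction l≡last l≢last

  replay : Strategy₁ → Strategy₂ → Strategy₂
  replay α β = follow (outcomePref α β) β

  -- The replayed outcome is not literally the β-outcome: its Δ-witnesses are
  -- transported along a propositional equality of states.
  SameView : ∀ {n} → Pref n → Pref n → Set
  SameView ρ ρ' = obsSeq ρ ≡ obsSeq ρ' × Last ρ ≡ Last ρ'

  ostep-cong : ∀ {n} {os os' : ObsSeq n} {σ σ' o o'} →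
               os ≡ os' → σ ≡ σ' → o ≡ o' → ostep os σ o ≡ ostep os' σ' o'
  ostep-cong refl refl refl = refl

  replay-sameView : {α : Strategy₁} → ObservationBased α → (β : Strategy₂) (i : ℕ) →
                    SameView (outcomePref α (replay α β) i) (outcomePref α β i)
  replay-sameView ob β zero = refl , refl
  replay-sameView {α} ob β (suc i) = ostep-cong sameObs sameAct (cong obs sameNext) , sameNext
    where
    ρ' ρ : Pref i
    ρ' = outcomePref α (replay α β) i
    ρ  = outcomePref α β i

    sameObs : obsSeq ρ' ≡ obsSeq ρ
    sameObs = proj₁ (replay-sameView ob β i)

    sameLast : Last ρ' ≡ Last ρ
    sameLast = proj₂ (replay-sameView ob β i)

    sameAct : α ρ' ≡ α ρ
    sameAct = ob ρ' ρ sameObs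

    sameNext : proj₁ (replay α β ρ' (α ρ')) ≡ proj₁ (β ρ (α ρ))
    sameNext = trans (followAt-agrees (outcomePref α β) β i sameLast (α ρ'))
                     (cong (λ σ → proj₁ (β ρ σ)) sameAct)

  replay-outcomeObs : {α : Strategy₁} → ObservationBased α → (β : Strategy₂) (i : ℕ) →
                      outcomeObs α (replay α β) i ≡ outcomeObs α β i
  replay-outcomeObs ob β i =
    cong₂ _,_ (cong obs (proj₂ (replay-sameView ob β i))) (ob _ _ (proj₁ (replay-sameView ob β i)))

  replay-satisfies : (Φ : Objective) {α : Strategy₁} → ObservationBased α → (β : Strategy₂) →
                     Satisfies Φ α (replay α β) → Satisfies Φ α β
  replay-satisfies Φ ob β = Objective.φ-resp Φ (replay-outcomeObs ob β)

proposition2p4 : (G : GameStructure) → (Φ : GameStructure.Objective G) →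
    (Σ (GameStructure.Strategy₁ G) λ α → GameStructure.ObservationBased G α ×
    (∀ (β : GameStructure.Strategy₂ G) → GameStructure.Satisfies G Φ α β))
    ⇔
    (Σ (GameStructure.Strategy₁ G) λ α → GameStructure.ObservationBased G α ×
    (∀ (β : GameStructure.Strategy₂ G) → GameStructure.Counting G β →
    GameStructure.Satisfies G Φ α β))
proposition2p4 G Φ = mk⇔
  (λ (α , ob , wins) → α , ob , λ β _ → wins β)
  (λ (α , ob , winsCounting) → α , ob , λ β →
     replay-satisfies G Φ ob β
       (winsCounting (replay G α β) (follow-counting G (outcomePref α β) β)))
  where open GameStructure G using (outcomePref)
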